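{- Let $k\geq 4$ be an even integer and let $G$ be a total $k$-uniform false twin-free graph. Then for any edge $uv\in E(G)$ the graph $G\setminus (N[u]\cup N[v])$ is also false twin-free.
   Context: All graphs are finite and simple. $N(v)$ is the set of neighbors of $v$ and $N[v]=N(v)\cup\{v\}$; $G\setminus S$ denotes the graph obtained by deleting the vertices of $S$. Two distinct vertices $u,v$ are false twins if $N(u)=N(v)$; a graph is false twin-free if it has no false twins. For a graph $G$ with no isolated vertices, a total dominating set is a set $A\subseteq V(G)$ such that every vertex of $G$ has a neighbor in $A$; $\gamma_t(G)$ is the minimum size of one. A sequence $(v_1,\dots,v_m)$ of distinct vertices is legal if $N(v_i)\setminus\bigcup_{j=1}^{i-1}N(v_j)\neq\emptyset$ for every $i\in\{2,\dots,m\}$; it is a total dominating sequence if moreover $\{v_1,\dots,v_m\}$ is a total dominating set. $\gamma_{gr}^t(G)$ is the maximum length of a total dominating sequence. $G$ is total $k$-uniform if $\gamma_t(G)=\gamma_{gr}^t(G)=k$. -}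

module Defs where

open import Data.Bool using (Bool; true; false; T; not; _∨_)
open import Data.Nat using (ℕ; _≤_; _<_; _≥_)
open import Data.Fin using (Fin; toℕ; _≟_)
open import Data.Fin.Subset using (Subset; _∈_; ∣_∣)
open import Data.List using (List; length; lookup)
open import Data.List.Relation.Unary.Unique.Propositional using (Unique)
open import Data.List.Membership.Propositional renaming (_∈_ to _∈ₗ_)
open import Data.Product using (Σ; ∃; _×_; _,_; proj₁)
open import Relation.Binary.PropositionalEquality using (_≡_; _≢_)
open import Relation.Nullary using (¬_)
open import Relation.Nullary.Decidable using (⌊_⌋)

record Graph (V : Set) : Set₁ where
  field
    adj    : V → V → Bool
    sym    : ∀ x y → adj x y ≡ adj y x
    irrefl : ∀ x → adj x x ≡ false
open Graph public

Adj : ∀ {V} → Graph V → V → V → Set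
Adj G x y = adj G x y ≡ true

-- Induced subgraph on the vertices satisfying a Boolean predicate `keep`.
-- (T b is ⊤ or ⊥, so vertices of the subgraph are equal iff their
-- underlying vertices are equal.)
induced : ∀ {V} → Graph V → (keep : V → Bool) → Graph (Σ V (λ x → T (keep x)))
induced G keep = record
  { adj = λ x y → adj G (proj₁ x) (proj₁ y)
  ; sym = λ x y → sym G (proj₁ x) (proj₁ y)
  ; irrefl = λ x → irrefl G (proj₁ x) }

FalseTwins : ∀ {V} → Graph V → V → V → Set
FalseTwins G x y = x ≢ y × (∀ z → adj G x z ≡ adj G y z)

FalseTwinFree : ∀ {V} → Graph V → Set
FalseTwinFree G = ∀ x y → ¬ FalseTwins G x y

closedNbhd₂ : ∀ {n} → Graph (Fin n) → Fin n → Fin n → Fin n → Bool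
closedNbhd₂ G u v x = ⌊ x ≟ u ⌋ ∨ ⌊ x ≟ v ⌋ ∨ adj G u x ∨ adj G v x

deleteClosedNbhds : ∀ {n} (G : Graph (Fin n)) (u v : Fin n) →
                    Graph (Σ (Fin n) (λ x → T (not (closedNbhd₂ G u v x))))
deleteClosedNbhds G u v = induced G (λ x → not (closedNbhd₂ G u v x))

IsTotalDominatingSet : ∀ {n} → Graph (Fin n) → Subset n → Set
IsTotalDominatingSet G A = ∀ x → ∃ λ y → y ∈ A × Adj G x y

TotalDominationNumberIs : ∀ {n} → Graph (Fin n) → ℕ → Set
TotalDominationNumberIs G k =
  (∃ λ A → IsTotalDominatingSet G A × ∣ A ∣ ≡ k) ×
  (∀ A → IsTotalDominatingSet G A → k ≤ ∣ A ∣)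

-- Legal sequence: distinct vertices, and each v_i (i ≥ 2, i.e. index ≥ 1)
-- has a neighbour not adjacent to any earlier v_j.
IsLegal : ∀ {n} → Graph (Fin n) → List (Fin n) → Set
IsLegal G s = Unique s ×
  (∀ (i : Fin (length s)) → 0 < toℕ i →
     ∃ λ w → Adj G (lookup s i) w ×
       (∀ (j : Fin (length s)) → toℕ j < toℕ i → ¬ Adj G (lookup s j) w))

IsTotalDominatingSequence : ∀ {n} → Graph (Fin n) → List (Fin n) → Set
IsTotalDominatingSequence G s =
  IsLegal G s × (∀ x → ∃ λ y → y ∈ₗ s × Adj G x y)

GameTotalDominationNumberIs : ∀ {n} → Graph (Fin n) → ℕ → Set
GameTotalDominationNumberIs G k =
  (∃ λ s → IsTotalDominatingSequence G s × length s ≡ k) ×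
  (∀ s → IsTotalDominatingSequence G s → length s ≤ k)

TotalUniform : ∀ {n} → Graph (Fin n) → ℕ → Set
TotalUniform G k = TotalDominationNumberIs G k × GameTotalDominationNumberIs G k

-- If x and y were false twins of G ∖ (N[u] ∪ N[v]) distinguished in G by a
-- neighbour z of x, then N(y) ⊆ N(x) ∪ N(u) ∪ N(v).  Extend x, u, v greedily to a
-- sequence s that totally dominates G: then y, x, u, v, … is legal
-- (z is private to x, v to u, u to v, and later footprints avoid N(x) ∪ N(u) ∪ N(v)),
-- so γ_gr^t(G) ≥ |s| + 1 > |s| ≥ γ_t(G).
module Submission where

open import Defs
open import Data.Nat using (ℕ; _≥_)
open import Data.Nat.Divisibility using (_∣_)
open import Data.Fin using (Fin)

open import Data.Bool using (true; false; T; not)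
open import Data.Bool.Properties using (T-irrelevant; T-≡; T-not-≡) renaming (_≟_ to _≟ᵇ_)
open import Data.Empty using (⊥; ⊥-elim)
open import Data.Fin using (toℕ; _≟_) renaming (zero to fzero; suc to fsuc)
open import Data.Fin.Properties using (¬∀⟶∃¬)
open import Data.Fin.Subset using (Subset; ⁅_⁆; _∪_; ∣_∣; inside; outside) renaming (⊥ to ∅; _∈_ to _∈ₛ_)
open import Data.Fin.Subset.Properties using (∣⊥∣≡0; ∣⁅x⁆∣≡1; x∈⁅x⁆; p⊆p∪q; q⊆p∪q)
open import Data.List using (List; []; _∷_; _++_; length; lookup; allFin)
open import Data.List.Membership.Propositional using (_∈_; find; lose)
open import Data.List.Membership.Propositional.Properties using (∈-allFin)
open import Data.List.Relation.Unary.All using (All; []; _∷_)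
open import Data.List.Relation.Unary.AllPairs using ([]; _∷_)
open import Data.List.Relation.Unary.Any using (Any; here; there; any?)
open import Data.List.Relation.Unary.Any.Properties using (++⁺ˡ; ++⁺ʳ)
open import Data.List.Relation.Unary.Unique.Propositional using (Unique)
open import Data.Nat using (_+_; _≤_; _<_; z≤n; s≤s)
open import Data.Nat.Properties using (≤-trans; ≤-reflexive; +-suc; +-mono-≤; +-monoʳ-≤; n≤1+n; n≮n)
open import Data.Product using (∃; _×_; _,_; proj₁; proj₂)
open import Data.Sum using (_⊎_; inj₁; inj₂; [_,_]′)
open import Data.Unit using (⊤; tt)
open import Data.Vec using (_∷_; [])
open import Function using (_∘_)
open import Function.Bundles using (Equivalence)
open import Relation.Binary.PropositionalEquality using (_≡_; _≢_; refl; trans; cong) renaming (sym to ≡-sym)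
open import Relation.Nullary using (¬_; yes; no)
open import Relation.Nullary.Decidable using (⌊_⌋)

∣p∪q∣≤∣p∣+∣q∣ : ∀ {n} (p q : Subset n) → ∣ p ∪ q ∣ ≤ ∣ p ∣ + ∣ q ∣
∣p∪q∣≤∣p∣+∣q∣ []            []            = z≤n
∣p∪q∣≤∣p∣+∣q∣ (inside ∷ p)  (outside ∷ q) = s≤s (∣p∪q∣≤∣p∣+∣q∣ p q)
∣p∪q∣≤∣p∣+∣q∣ (inside ∷ p)  (inside ∷ q)  =
  s≤s (≤-trans (∣p∪q∣≤∣p∣+∣q∣ p q) (+-monoʳ-≤ ∣ p ∣ (n≤1+n ∣ q ∣)))
∣p∪q∣≤∣p∣+∣q∣ (outside ∷ p) (inside ∷ q)  rewrite +-suc ∣ p ∣ ∣ q ∣ = s≤s (∣p∪q∣≤∣p∣+∣q∣ p q)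
∣p∪q∣≤∣p∣+∣q∣ (outside ∷ p) (outside ∷ q) = ∣p∪q∣≤∣p∣+∣q∣ p q

fromList : ∀ {n} → List (Fin n) → Subset n
fromList []      = ∅
fromList (a ∷ s) = ⁅ a ⁆ ∪ fromList s

∣fromList∣≤length : ∀ {n} (s : List (Fin n)) → ∣ fromList s ∣ ≤ length s
∣fromList∣≤length {n} [] = ≤-reflexive (∣⊥∣≡0 n)
∣fromList∣≤length (a ∷ s) =
  ≤-trans (∣p∪q∣≤∣p∣+∣q∣ ⁅ a ⁆ (fromList s)) (+-mono-≤ (≤-reflexive (∣⁅x⁆∣≡1 a)) (∣fromList∣≤length s))

∈⇒∈fromList : ∀ {n} {x : Fin n} {s} → x ∈ s → x ∈ₛ fromList s
∈⇒∈fromList {s = a ∷ s} (here refl) = p⊆p∪q (fromList s) (x∈⁅x⁆ a)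
∈⇒∈fromList {s = a ∷ s} (there x∈s) = q⊆p∪q ⁅ a ⁆ (fromList s) (∈⇒∈fromList x∈s)

module _ {n : ℕ} (G : Graph (Fin n)) where

  Adj-sym : ∀ {x y} → Adj G x y → Adj G y x
  Adj-sym {x} {y} xy = trans (sym G y x) xy

  ≡false⇒¬Adj : ∀ {x y} → adj G x y ≡ false → ¬ Adj G x y
  ≡false⇒¬Adj x≁y x∼y with trans (≡-sym x≁y) x∼y
  ... | ()

  ¬Adj-refl : ∀ x → ¬ Adj G x x
  ¬Adj-refl x = ≡false⇒¬Adj (irrefl G x)

  distinguishing-vertex : ∀ {x y} → ¬ (∀ z → adj G x z ≡ adj G y z) →
    ∃ λ z → (Adj G x z × ¬ Adj G y z) ⊎ (Adj G y z × ¬ Adj G x z)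
  distinguishing-vertex {x} {y} ¬same
    with ¬∀⟶∃¬ n (λ z → adj G x z ≡ adj G y z) (λ z → adj G x z ≟ᵇ adj G y z) ¬same
  ... | z , differ with adj G x z in xz | adj G y z in yz
  ... | true  | true  = ⊥-elim (differ refl)
  ... | true  | false = z , inj₁ (xz , ≡false⇒¬Adj yz)
  ... | false | true  = z , inj₂ (yz , ≡false⇒¬Adj xz)
  ... | false | false = ⊥-elim (differ refl)

  Dominated : List (Fin n) → Fin n → Set
  Dominated s w = Any (λ q → Adj G q w) s

  Dominates : List (Fin n) → Set
  Dominates s = ∀ w → Dominated s w

  -- p holds the vertices already played, most recent first.
  LegalAfter : List (Fin n) → List (Fin n) → Set
  LegalAfter p []      = ⊤
  LegalAfter p (t ∷ s) = (∃ λ w → Adj G t w × ¬ Dominated p w) × LegalAfter (t ∷ p) s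

  LegalAfter⇒∉ : ∀ {p q} s → LegalAfter p s → q ∈ p → All (q ≢_) s
  LegalAfter⇒∉ []      _                          _   = []
  LegalAfter⇒∉ (t ∷ s) ((w , t∼w , ¬dom) , legal) q∈p =
    (λ { refl → ¬dom (lose q∈p t∼w) }) ∷ LegalAfter⇒∉ s legal (there q∈p)

  LegalAfter⇒Unique : ∀ {p} s → LegalAfter p s → Unique s
  LegalAfter⇒Unique []      _           = []
  LegalAfter⇒Unique (t ∷ s) (_ , legal) = LegalAfter⇒∉ s legal (here refl) ∷ LegalAfter⇒Unique s legal

  LegalAfter⇒footprint : ∀ {p} s → LegalAfter p s → (i : Fin (length s)) →
    ∃ λ w → Adj G (lookup s i) w × ¬ Dominated p w ×
      (∀ (j : Fin (length s)) → toℕ j < toℕ i → ¬ Adj G (lookup s j) w)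
  LegalAfter⇒footprint (t ∷ s) ((w , t∼w , ¬dom) , _) fzero = w , t∼w , ¬dom , λ _ ()
  LegalAfter⇒footprint (t ∷ s) (_ , legal) (fsuc i) with LegalAfter⇒footprint s legal i
  ... | w , sᵢ∼w , ¬dom , ¬earlier = w , sᵢ∼w , ¬dom ∘ there , ¬earlier′
    where
    ¬earlier′ : ∀ (j : Fin (length (t ∷ s))) → toℕ j < toℕ (fsuc i) → ¬ Adj G (lookup (t ∷ s) j) w
    ¬earlier′ fzero    _         = ¬dom ∘ here
    ¬earlier′ (fsuc j) (s≤s j<i) = ¬earlier j j<i

  LegalAfter[]⇒IsLegal : ∀ s → LegalAfter [] s → IsLegal G s
  LegalAfter[]⇒IsLegal s legal =
    LegalAfter⇒Unique s legal ,
    λ i _ → let w , sᵢ∼w , _ , ¬earlier = LegalAfter⇒footprint s legal i in w , sᵢ∼w , ¬earlier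

  LegalAfter-antitone : ∀ {p₁ p₂} s → (∀ {w} → Dominated p₂ w → Dominated p₁ w) →
    LegalAfter p₁ s → LegalAfter p₂ s
  LegalAfter-antitone []      _     _                          = tt
  LegalAfter-antitone (t ∷ s) p₂⊑p₁ ((w , t∼w , ¬dom) , legal) =
    (w , t∼w , ¬dom ∘ p₂⊑p₁) ,
    LegalAfter-antitone s (λ { (here t∼w′) → here t∼w′ ; (there dom) → there (p₂⊑p₁ dom) }) legal

  -- Each vertex w not yet dominated gets a neighbour appended, with w as its footprint.
  greedy-extension : (∀ w → ∃ λ q → Adj G w q) → ∀ p ws →
    ∃ λ c → LegalAfter p c × (∀ {w} → w ∈ ws → Dominated p w ⊎ Dominated c w)
  greedy-extension nb p []       = [] , tt , λ ()
  greedy-extension nb p (w ∷ ws) with any? (λ q → adj G q w ≟ᵇ true) p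
  ... | yes dom =
    let c , legal , covers = greedy-extension nb p ws
    in  c , legal , λ { (here refl) → inj₁ dom ; (there w′∈ws) → covers w′∈ws }
  ... | no ¬dom =
    let q , w∼q = nb w
        c , legal , covers = greedy-extension nb (q ∷ p) ws
        shift : ∀ {w′} → Dominated (q ∷ p) w′ ⊎ Dominated c w′ → Dominated p w′ ⊎ Dominated (q ∷ c) w′
        shift = λ { (inj₁ (here q∼w′)) → inj₂ (here q∼w′)
                  ; (inj₁ (there dom)) → inj₁ dom
                  ; (inj₂ dom)         → inj₂ (there dom) }
    in  q ∷ c , ((w , Adj-sym w∼q , ¬dom) , legal) ,
        λ { (here refl) → inj₂ (here (Adj-sym w∼q)) ; (there w′∈ws) → shift (covers w′∈ws) }

  legal-completion : (∀ w → ∃ λ q → Adj G w q) → ∀ p → ∃ λ c → LegalAfter p c × Dominates (p ++ c)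
  legal-completion nb p =
    let c , legal , covers = greedy-extension nb p (allFin n)
    in  c , legal , λ w → [ ++⁺ˡ , ++⁺ʳ p ]′ (covers (∈-allFin w))

  uniform⇒no-isolated : ∀ {k} → TotalUniform G k → ∀ w → ∃ λ q → Adj G w q
  uniform⇒no-isolated (((_ , total , _) , _) , _) w = let q , _ , w∼q = total w in q , w∼q

  Dominates⇒∃∈ : ∀ {s} → Dominates s → ∀ w → ∃ λ q → q ∈ s × Adj G w q
  Dominates⇒∃∈ dom w = let q , q∈s , q∼w = find (dom w) in q , q∈s , Adj-sym q∼w

  uniform⇒¬legal-cons : ∀ {k y s} → TotalUniform G k → Dominates s → ¬ IsLegal G (y ∷ s)
  uniform⇒¬legal-cons {s = s} ((_ , minimal) , (_ , maximal)) dom legal =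
    n≮n (length s) (≤-trans (maximal _ (legal , y∷s-dominates))
                            (≤-trans (minimal _ s-total) (∣fromList∣≤length s)))
    where
    y∷s-dominates : ∀ w → ∃ λ q → q ∈ _ ∷ s × Adj G w q
    y∷s-dominates w = let q , q∈s , w∼q = Dominates⇒∃∈ dom w in q , there q∈s , w∼q
    s-total : IsTotalDominatingSet G (fromList s)
    s-total w = let q , q∈s , w∼q = Dominates⇒∃∈ dom w in q , ∈⇒∈fromList q∈s , w∼q

  ∉closedNbhd₂⇒¬Adj : ∀ {u v x} → T (not (closedNbhd₂ G u v x)) → ¬ Adj G u x × ¬ Adj G v x
  ∉closedNbhd₂⇒¬Adj {u} {v} {x} x∉ with ⌊ x ≟ u ⌋ | ⌊ x ≟ v ⌋ | adj G u x | adj G v x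
  ... | false | false | false | false = (λ ()) , (λ ())
  ... | true  | _     | _     | _     = ⊥-elim x∉
  ... | false | true  | _     | _     = ⊥-elim x∉
  ... | false | false | true  | _     = ⊥-elim x∉
  ... | false | false | false | true  = ⊥-elim x∉

  ∈closedNbhd₂ : ∀ {u v x} → T (closedNbhd₂ G u v x) → x ≡ u ⊎ x ≡ v ⊎ Adj G u x ⊎ Adj G v x
  ∈closedNbhd₂ {u} {v} {x} x∈ with x ≟ u | x ≟ v | adj G u x | adj G v x
  ... | yes x≡u | _       | _     | _     = inj₁ x≡u
  ... | no _    | yes x≡v | _     | _     = inj₂ (inj₁ x≡v)
  ... | no _    | no _    | true  | _     = inj₂ (inj₂ (inj₁ refl))
  ... | no _    | no _    | false | true  = inj₂ (inj₂ (inj₂ refl))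
  ... | no _    | no _    | false | false = ⊥-elim x∈

  SameNeighboursOutside : (u v x y : Fin n) → Set
  SameNeighboursOutside u v x y = ∀ w → T (not (closedNbhd₂ G u v w)) → adj G x w ≡ adj G y w

  twin-neighbour : ∀ {u v x y w} → T (not (closedNbhd₂ G u v y)) → SameNeighboursOutside u v x y →
    Adj G y w → Dominated (x ∷ u ∷ v ∷ []) w
  twin-neighbour {u} {v} {x} {y} {w} y∉ same y∼w with closedNbhd₂ G u v w in w∈?
  ... | false = here (trans (same w (Equivalence.from T-not-≡ w∈?)) y∼w)
  ... | true with ∈closedNbhd₂ {u} {v} {w} (Equivalence.from T-≡ w∈?)
  ...   | inj₁ refl               = ⊥-elim (proj₁ (∉closedNbhd₂⇒¬Adj y∉) (Adj-sym y∼w))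
  ...   | inj₂ (inj₁ refl)        = ⊥-elim (proj₂ (∉closedNbhd₂⇒¬Adj y∉) (Adj-sym y∼w))
  ...   | inj₂ (inj₂ (inj₁ u∼w)) = there (here u∼w)
  ...   | inj₂ (inj₂ (inj₂ v∼w)) = there (there (here v∼w))

  split-twin⇒legal-cons : ∀ {u v x y z} → (∀ w → ∃ λ q → Adj G w q) → Adj G u v →
    T (not (closedNbhd₂ G u v x)) → T (not (closedNbhd₂ G u v y)) → SameNeighboursOutside u v x y →
    Adj G x z → ¬ Adj G y z → ∃ λ s → Dominates s × IsLegal G (y ∷ s)
  split-twin⇒legal-cons {u} {v} {x} {y} {z} nb u∼v x∉ y∉ same x∼z y≁z =
    let c , legal , dom = legal-completion nb (x ∷ u ∷ v ∷ [])
        q , y∼q         = nb y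
    in  x ∷ u ∷ v ∷ c , dom ,
        LegalAfter[]⇒IsLegal (y ∷ x ∷ u ∷ v ∷ c)
          ( (q , y∼q , λ ())
          , (z , x∼z , λ { (here y∼z) → y≁z y∼z })
          , (v , u∼v , λ { (here x∼v) → v≁x (Adj-sym x∼v) ; (there (here y∼v)) → v≁y (Adj-sym y∼v) })
          , (u , Adj-sym u∼v , λ { (here u∼u)                → ¬Adj-refl u u∼u
                                 ; (there (here x∼u))         → u≁x (Adj-sym x∼u)
                                 ; (there (there (here y∼u))) → u≁y (Adj-sym y∼u) })
          , LegalAfter-antitone c shrink legal )
    where
    u≁x : ¬ Adj G u x
    u≁x = proj₁ (∉closedNbhd₂⇒¬Adj x∉)
    v≁x : ¬ Adj G v x
    v≁x = proj₂ (∉closedNbhd₂⇒¬Adj x∉)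
    u≁y : ¬ Adj G u y
    u≁y = proj₁ (∉closedNbhd₂⇒¬Adj y∉)
    v≁y : ¬ Adj G v y
    v≁y = proj₂ (∉closedNbhd₂⇒¬Adj y∉)

    shrink : ∀ {w} → Dominated (v ∷ u ∷ x ∷ y ∷ []) w → Dominated (x ∷ u ∷ v ∷ []) w
    shrink (here v∼w)                         = there (there (here v∼w))
    shrink (there (here u∼w))                 = there (here u∼w)
    shrink (there (there (here x∼w)))         = here x∼w
    shrink (there (there (there (here y∼w)))) = twin-neighbour y∉ same y∼w

  uniform⇒¬split-twins : ∀ {k u v x y z} → TotalUniform G k → Adj G u v →
    T (not (closedNbhd₂ G u v x)) → T (not (closedNbhd₂ G u v y)) → SameNeighboursOutside u v x y →
    Adj G x z → ¬ Adj G y z → ⊥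
  uniform⇒¬split-twins uniform u∼v x∉ y∉ same x∼z y≁z =
    let _ , dom , legal = split-twin⇒legal-cons (uniform⇒no-isolated uniform) u∼v x∉ y∉ same x∼z y≁z
    in  uniform⇒¬legal-cons uniform dom legal

-- Only γ_t(G) = γ_gr^t(G) is used.
lemma2p6 : (k : ℕ) → k ≥ 4 → 2 ∣ k →
    (n : ℕ) (G : Graph (Fin n)) → TotalUniform G k → FalseTwinFree G →
    (u v : Fin n) → Adj G u v →
    FalseTwinFree (deleteClosedNbhds G u v)
lemma2p6 k _ _ n G uniform twin-free u v u∼v (x , x∉) (y , y∉) (x≢y , same)
  with distinguishing-vertex G (λ sameᴳ → twin-free x y (x≢yᴳ , sameᴳ))
  where
  x≢yᴳ : x ≢ y
  x≢yᴳ refl = x≢y (cong (x ,_) (T-irrelevant x∉ y∉))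
... | z , inj₁ (x∼z , y≁z) = uniform⇒¬split-twins G uniform u∼v x∉ y∉ (λ w w∉ → same (w , w∉)) x∼z y≁z
... | z , inj₂ (y∼z , x≁z) = uniform⇒¬split-twins G uniform u∼v y∉ x∉ (λ w w∉ → ≡-sym (same (w , w∉))) y∼z x≁z
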